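{- Let $(t_1,\dots,t_m)$ be a non-trivial cycle with $n$ runs and node divisors $p_1,q_1,\dots,p_n,q_n$ (node indices read modulo $n$). Suppose exactly two of $p_1,q_1,\dots,p_n,q_n$ equal $1$, and that these two are $p_i$ and $q_i$ for the same index $i$. Then $(p_{i+1},q_{i+1})\in\{(3,3),(3,5),(5,3)\}$.
   Context: The subprime Fibonacci rule: from positive integers $x,y$ with $s=x+y$, the next term is $s$ if $s$ is prime and $s/p$ if $s$ is composite, $p$ the smallest prime factor of $s$. A non-trivial cycle of length $m$ is an $m$-tuple $(t_1,\dots,t_m)$ of positive integers, indices modulo $m$, with each $t_i$ obtained from $t_{i-2},t_{i-1}$ by this rule, the $t_i$ not all equal, and $m$ the minimal period. Its signature is $s_i=(t_{i-2}+t_{i-1})/t_i$. In such a cycle every even term is followed by two odd terms; if $t_e$ is even, the pair $(a,b)=(t_{e+1},t_{e+2})$ is a node, and the run of the node is $t_{e+1}$ up to the next even term. Let the $n$ even terms of one period (the number of runs) give nodes $(a_1,b_1),\dots,(a_n,b_n)$ in cyclic order (so node $i+1$ is the node following node $i$, with $n+1$ read as $1$), and let $p_i$ and $q_i$ be the signature values of $a_i$ and $b_i$ respectively (the divisors). Each $p_i,q_i$ is $1$ or an odd prime. -}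

module Defs where

open import Data.Nat using (ℕ; zero; suc; _+_; _*_; _∸_; _≤_; _<_)
open import Data.Nat.DivMod using (_/_)
open import Data.Nat.Divisibility using (_∣_)
open import Data.Nat.Primality using (Prime; Composite)
open import Data.Product using (Σ; _×_; ∃)
open import Data.Sum using (_⊎_)
open import Relation.Binary.PropositionalEquality using (_≡_; _≢_)
open import Relation.Nullary using (¬_)

IsSmallestPrimeFactor : ℕ → ℕ → Set
IsSmallestPrimeFactor p s = Prime p × p ∣ s × (∀ q → Prime q → q ∣ s → p ≤ q)

SubprimeStep : ℕ → ℕ → ℕ → Set
SubprimeStep x y z =
  (Prime (x + y) × z ≡ x + y)
  ⊎ (Composite (x + y) × Σ ℕ (λ p → IsSmallestPrimeFactor p (x + y) × z * p ≡ x + y))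

-- A non-trivial cycle of length m, represented as an m-periodic sequence
-- t : ℕ → ℕ (t i is the term with index i mod m).
record NontrivialCycle (m : ℕ) (t : ℕ → ℕ) : Set where
  field
    positive  : ∀ i → 0 < t i
    periodic  : ∀ i → t (i + m) ≡ t i
    rule      : ∀ i → SubprimeStep (t i) (t (suc i)) (t (suc (suc i)))
    notConst  : Σ ℕ (λ i → Σ ℕ (λ j → t i ≢ t j))
    minimal   : 0 < m × (∀ k → 0 < k → k < m → ¬ (∀ i → t (i + k) ≡ t i))

-- natural-number division, total (division by 0 returns 0; never used
-- on a zero divisor since all cycle terms are positive)
div : ℕ → ℕ → ℕ
div a zero = 0
div a (suc b) = a / suc b

sig : (ℕ → ℕ) → ℕ → ℕ
sig t i = div (t (i ∸ 2) + t (i ∸ 1)) (t i)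

Even : ℕ → Set
Even x = 2 ∣ x

-- For an even term t_e (e ≥ 1), the node is (t_{e+1}, t_{e+2}); its divisors
-- are p = s_{e+1} and q = s_{e+2}.
nodeP : (ℕ → ℕ) → ℕ → ℕ
nodeP t e = sig t (e + 1)

nodeQ : (ℕ → ℕ) → ℕ → ℕ
nodeQ t e = sig t (e + 2)

IsNextEven : (ℕ → ℕ) → ℕ → ℕ → Set
IsNextEven t e e' = e < e' × Even (t e') × (∀ k → e < k → k < e' → ¬ Even (t k))

-- Write (u, y) for the two terms before the exceptional node and weigh a pair (x₀, x₁) of consecutive
-- terms by x₀ + 2 x₁.  Between two even terms all terms are odd, so the rule averages them: the weight is
-- kept and the gap x₁ - x₀ is halved (a prime sum of two odd terms is 1 + 1, and 1, 2 cannot occur in a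
-- cycle).  Away from the exceptional node every divisor is at least 2, so no step increases the weight,
-- whereas the exceptional node (u + y, u + 2 y) raises it from u + 2 y to 3 u + 5 y.  A node with both
-- divisors at least 3 shrinks the weight to 11/18 of it or less; if a third node follows, the next node
-- therefore has to keep the weight above 18/11 (u + 2 y), which only p = q = 3 allows.  With just two
-- nodes, the second run returns to (u, y); then linear inequalities in the lengths of the two runs (one,
-- two, or at least three steps) leave only (3,3), (3,5), (5,3), apart from two exact configurations that
-- force (u, y) = (7, 6) or (1, 2) and are excluded by hand.

module Submission where

open import Defs
open import Data.Nat using (ℕ; zero; suc; _+_; _*_; _∸_; _^_; _≤_; _<_; z≤n; s≤s; s≤s⁻¹; ∣_-_∣; _≟_; _≤?_;
  NonZero; >-nonZero; >-nonZero⁻¹; nonTrivial⇒n>1)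
open import Data.Nat.Properties
open import Data.Nat.DivMod using (_/_; _%_; m≡m%n+[m/n]*n; m%n<n; m*n/n≡m)
open import Data.Nat.Coprimality using (Coprime; coprime?; coprime-divisor)
open import Data.Nat.Divisibility using (_∣_; _∣?_; divides; ∣m∣n⇒∣m+n; ∣m+n∣m⇒∣n; ∣m⇒∣m*n)
open import Data.Nat.Primality
  using (Prime; Composite; prime?; prime⇒irreducible; prime⇒nonTrivial; prime⇒¬composite; prime[2])
open import Data.Nat.Tactic.RingSolver using (solve)
open import Data.List using (_∷_; [])
open import Data.Product using (Σ; _×_; _,_; proj₁; proj₂)
open import Data.Sum using (_⊎_; inj₁; inj₂)
open import Data.Empty using (⊥; ⊥-elim)
open import Function using (_∘_)
open import Relation.Nullary using (¬_; yes; no; Dec)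
open import Relation.Nullary.Decidable using (from-yes; from-no)
open import Relation.Binary.PropositionalEquality
  using (_≡_; _≢_; refl; sym; trans; cong; cong₂; subst; subst₂; module ≡-Reasoning)

-- Linear certificates

infixl 6 _⊕_ _⊕₌_
infixr 7 _⊛_ _⊛₌_

_⊕_ : ∀ {a b c d} → a ≤ b → c ≤ d → a + c ≤ b + d
_⊕_ = +-mono-≤

_⊛_ : ∀ k {a b} → a ≤ b → k * a ≤ k * b
k ⊛ a≤b = *-monoʳ-≤ k a≤b

_⊕₌_ : ∀ {a b c d} → a ≡ b → c ≡ d → a + c ≡ b + d
_⊕₌_ = cong₂ _+_

_⊛₌_ : ∀ k {a b} → a ≡ b → k * a ≡ k * b
k ⊛₌ a≡b = cong (k *_) a≡b

≥-reflexive : ∀ {a b} → a ≡ b → b ≤ a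
≥-reflexive a≡b = ≤-reflexive (sym a≡b)

-- A system of linear constraints is refuted by a nonnegative combination l ≤ r of them for
-- which the ring solver proves l = r + 1 + k (a Farkas certificate).  Both lemmas are opaque:
-- otherwise Agda normalises the solver proofs when it analyses the clauses that use them.
opaque
  infeasible : ∀ {l r} k → l ≤ r → l ≡ r + suc k → ⊥
  infeasible {r = r} k l≤r refl = m+1+n≰m r l≤r

  linear-consequence : ∀ {l r} k x z .{{_ : NonZero k}} → l ≡ r → l + k * x ≡ r + k * z → x ≡ z
  linear-consequence {r = r} k x z refl eq = *-cancelˡ-≡ x z k (+-cancelˡ-≡ r (k * x) (k * z) eq)

quotient-bound : ∀ a {k p s} → k ≤ p → a * p ≡ s → k * a ≤ s
quotient-bound a {k} {p} k≤p a*p≡s = subst (k * a ≤_) (trans (*-comm p a) a*p≡s) (*-monoˡ-≤ a k≤p)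

-- Parity and primes

Odd : ℕ → Set
Odd n = ¬ Even n

even∨suc-even : ∀ n → Even n ⊎ Even (suc n)
even∨suc-even zero = inj₁ (divides 0 refl)
even∨suc-even (suc n) with even∨suc-even n
... | inj₁ (divides q n≡q*2) = inj₂ (divides (suc q) (cong (2 +_) n≡q*2))
... | inj₂ even = inj₁ even

odd+odd : ∀ {x y} → Odd x → Odd y → Even (x + y)
odd+odd {x} {y} odd-x odd-y =
  ∣m+n∣m⇒∣n (subst (2 ∣_) (+-suc (suc x) y) (∣m∣n⇒∣m+n (suc-even odd-x) (suc-even odd-y))) (divides 1 refl)
  where
  suc-even : ∀ {n} → Odd n → Even (suc n)
  suc-even {n} odd-n with even∨suc-even n
  ... | inj₁ even = ⊥-elim (odd-n even)
  ... | inj₂ even = even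

odd+even : ∀ {x y} → Odd x → Even y → Odd (x + y)
odd+even {x} {y} odd-x even-y even-x+y = odd-x (∣m+n∣m⇒∣n (subst (2 ∣_) (+-comm x y) even-x+y) even-y)

even+odd : ∀ {x y} → Even x → Odd y → Odd (x + y)
even+odd even-x odd-y even-x+y = odd-y (∣m+n∣m⇒∣n even-x+y even-x)

odd-factor : ∀ {z d s} → z * d ≡ s → Odd s → Odd z
odd-factor {d = d} refl odd-s even-z = odd-s (∣m⇒∣m*n d even-z)

even⇒≥2 : ∀ {n} → 0 < n → Even n → 2 ≤ n
even⇒≥2 0<n (divides zero refl) = ⊥-elim (<-irrefl refl 0<n)
even⇒≥2 {n} _ (divides (suc q) n≡[1+q]*2) = subst (2 ≤_) (sym n≡[1+q]*2) (m≤m+n 2 (q * 2))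

sum≡2⇒ones : ∀ {x y} → 1 ≤ x → 1 ≤ y → x + y ≡ 2 → x ≡ 1 × y ≡ 1
sum≡2⇒ones {1} {1} _ _ _ = refl , refl
sum≡2⇒ones {1} {suc (suc _)} _ _ ()
sum≡2⇒ones {2} {suc _} _ _ ()
sum≡2⇒ones {suc (suc (suc _))} {suc _} _ _ ()

prime⇒2≤ : ∀ {p} → Prime p → 2 ≤ p
prime⇒2≤ {p} pr = nonTrivial⇒n>1 p {{prime⇒nonTrivial pr}}

even-prime : ∀ {p} → Prime p → Even p → p ≡ 2
even-prime pr even with prime⇒irreducible pr even
... | inj₁ ()
... | inj₂ 2≡p = sym 2≡p

prime≥3⇒odd : ∀ {s} → Prime s → 3 ≤ s → Odd s
prime≥3⇒odd s-prime 3≤s even = <-irrefl refl (subst (3 ≤_) (even-prime s-prime even) 3≤s)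

spf-of-even : ∀ {p s} → IsSmallestPrimeFactor p s → Even s → p ≡ 2
spf-of-even (pr , _ , least) even = ≤-antisym (least 2 prime[2] even) (prime⇒2≤ pr)

spf-of-odd : ∀ {p s} → IsSmallestPrimeFactor p s → Odd s → 3 ≤ p
spf-of-odd {p} (pr , p∣s , _) odd = ≤∧≢⇒< (prime⇒2≤ pr) λ 2≡p → odd (subst (_∣ _) (sym 2≡p) p∣s)

odd-prime-cases : ∀ {p} → Prime p → 3 ≤ p → p ≡ 3 ⊎ p ≡ 5 ⊎ p ≡ 7 ⊎ 11 ≤ p
odd-prime-cases {0} _ ()
odd-prime-cases {1} _ (s≤s ())
odd-prime-cases {2} _ (s≤s (s≤s ()))
odd-prime-cases {3} _ _ = inj₁ refl
odd-prime-cases {4} pr _ = ⊥-elim (from-no (prime? 4) pr)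
odd-prime-cases {5} _ _ = inj₂ (inj₁ refl)
odd-prime-cases {6} pr _ = ⊥-elim (from-no (prime? 6) pr)
odd-prime-cases {7} _ _ = inj₂ (inj₂ (inj₁ refl))
odd-prime-cases {8} pr _ = ⊥-elim (from-no (prime? 8) pr)
odd-prime-cases {9} pr _ = ⊥-elim (from-no (prime? 9) pr)
odd-prime-cases {10} pr _ = ⊥-elim (from-no (prime? 10) pr)
odd-prime-cases {suc (suc (suc (suc (suc (suc (suc (suc (suc (suc (suc n))))))))))} _ _ =
  inj₂ (inj₂ (inj₂ (m≤m+n 11 n)))

proportional-prime-sum : ∀ α β {u y} .{{_ : NonZero α}} .{{_ : NonZero β}} → Coprime α β →
  β * u ≡ α * y → Prime (u + y) → u ≡ α × y ≡ β
proportional-prime-sum α β {u} {y} coprime βu≡αy pr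
  with coprime-divisor coprime (divides y (trans βu≡αy (*-comm α y)))
... | divides k u≡kα = u≡α , y≡β
  where
  y≡βk : y ≡ β * k
  y≡βk = *-cancelˡ-≡ y (β * k) α (begin
    α * y       ≡⟨ sym βu≡αy ⟩
    β * u       ≡⟨ cong (β *_) u≡kα ⟩
    β * (k * α) ≡⟨ solve (α ∷ β ∷ k ∷ []) ⟩
    α * (β * k) ∎)
    where open ≡-Reasoning
  sum≡ : u + y ≡ k * (α + β)
  sum≡ = trans (cong₂ _+_ u≡kα y≡βk) (solve (α ∷ β ∷ k ∷ []))
  1+1≤α+β : 1 + 1 ≤ α + β
  1+1≤α+β = +-mono-≤ (>-nonZero⁻¹ α) (>-nonZero⁻¹ β)
  k≡1 : k ≡ 1
  k≡1 with prime⇒irreducible pr (divides k sum≡)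
  ... | inj₁ α+β≡1 = ⊥-elim (<-irrefl refl (subst (2 ≤_) α+β≡1 1+1≤α+β))
  ... | inj₂ α+β≡u+y = sym (*-cancelʳ-≡ 1 k (α + β) {{>-nonZero (≤-trans (n≤1+n 1) 1+1≤α+β)}}
                              (trans (+-identityʳ (α + β)) (trans α+β≡u+y sum≡)))
  u≡α : u ≡ α
  u≡α = trans u≡kα (trans (cong (_* α) k≡1) (*-identityˡ α))
  y≡β : y ≡ β
  y≡β = trans y≡βk (trans (cong (β *_) k≡1) (*-identityʳ β))

-- Averaging runs

data Averaging : ℕ → ℕ → ℕ → ℕ → ℕ → Set where
  done : ∀ {x₀ x₁} → Averaging 0 x₀ x₁ x₀ x₁
  step : ∀ {n x₀ x₁ c z₀ z₁} → 2 * c ≡ x₀ + x₁ → Averaging n x₁ c z₀ z₁ → Averaging (suc n) x₀ x₁ z₀ z₁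

weight-shift : ∀ x y → y + (x + y) ≡ x + 2 * y
weight-shift x y = solve (x ∷ y ∷ [])

averaging-weight : ∀ {n x₀ x₁ z₀ z₁} → Averaging n x₀ x₁ z₀ z₁ → x₀ + 2 * x₁ ≡ z₀ + 2 * z₁
averaging-weight done = refl
averaging-weight {x₀ = x₀} {x₁} (step {c = c} 2c≡x₀+x₁ rest) = begin
  x₀ + 2 * x₁    ≡⟨ weight-shift x₀ x₁ ⟨
  x₁ + (x₀ + x₁) ≡⟨ cong (x₁ +_) 2c≡x₀+x₁ ⟨
  x₁ + 2 * c     ≡⟨ averaging-weight rest ⟩
  _              ∎
  where open ≡-Reasoning

halve-gap : ∀ {x₀ x₁ c} → 2 * c ≡ x₀ + x₁ → 2 * ∣ c - x₁ ∣ ≡ ∣ x₁ - x₀ ∣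
halve-gap {x₀} {x₁} {c} 2c≡x₀+x₁ = begin
  2 * ∣ c - x₁ ∣              ≡⟨ *-distribˡ-∣-∣ 2 c x₁ ⟩
  ∣ 2 * c - 2 * x₁ ∣          ≡⟨ cong₂ ∣_-_∣ (trans 2c≡x₀+x₁ (+-comm x₀ x₁)) (solve (x₁ ∷ [])) ⟩
  ∣ x₁ + x₀ - x₁ + x₁ ∣       ≡⟨ ∣m+n-m+o∣≡∣n-o∣ x₁ x₀ x₁ ⟩
  ∣ x₀ - x₁ ∣                 ≡⟨ ∣-∣-comm x₀ x₁ ⟩
  ∣ x₁ - x₀ ∣                 ∎
  where open ≡-Reasoning

averaging-gap : ∀ {n x₀ x₁ z₀ z₁} → Averaging n x₀ x₁ z₀ z₁ → 2 ^ n * ∣ z₁ - z₀ ∣ ≡ ∣ x₁ - x₀ ∣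
averaging-gap {z₀ = z₀} {z₁} done = +-identityʳ ∣ z₁ - z₀ ∣
averaging-gap {suc n} {x₀} {x₁} {z₀} {z₁} (step {c = c} 2c≡x₀+x₁ rest) =
  trans (*-assoc 2 (2 ^ n) ∣ z₁ - z₀ ∣) (trans (cong (2 *_) (averaging-gap rest)) (halve-gap {x₀} {x₁} {c} 2c≡x₀+x₁))

averaging-gap-≤ : ∀ {k n x₀ x₁ z₀ z₁} → k ≤ n → Averaging n x₀ x₁ z₀ z₁ → 2 ^ k * ∣ z₁ - z₀ ∣ ≤ ∣ x₁ - x₀ ∣
averaging-gap-≤ {z₀ = z₀} {z₁} k≤n run =
  subst (_ ≤_) (averaging-gap run) (*-monoˡ-≤ ∣ z₁ - z₀ ∣ (^-monoʳ-≤ 2 k≤n))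

data AveragingView (x₀ x₁ z₀ z₁ : ℕ) : Set where
  one-step      : z₀ ≡ x₁ → 2 * z₁ ≡ x₀ + x₁ → AveragingView x₀ x₁ z₀ z₁
  two-steps     : ∀ c → 2 * c ≡ x₀ + x₁ → z₀ ≡ c → 2 * z₁ ≡ x₁ + c → AveragingView x₀ x₁ z₀ z₁
  three-or-more : 8 * ∣ z₁ - z₀ ∣ ≤ ∣ x₁ - x₀ ∣ → AveragingView x₀ x₁ z₀ z₁

averaging-view : ∀ {n x₀ x₁ z₀ z₁} → Averaging (suc n) x₀ x₁ z₀ z₁ → AveragingView x₀ x₁ z₀ z₁
averaging-view (step 2z₁≡x₀+x₁ done) = one-step refl 2z₁≡x₀+x₁
averaging-view (step 2c≡x₀+x₁ (step 2z₁≡x₁+c done)) = two-steps _ 2c≡x₀+x₁ refl 2z₁≡x₁+c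
averaging-view run@(step _ (step _ (step _ _))) = three-or-more (averaging-gap-≤ (s≤s (s≤s (s≤s z≤n))) run)

gap-bounds : ∀ k x z {d} → k * ∣ x - z ∣ ≤ d → k * x ≤ k * z + d × k * z ≤ k * x + d
gap-bounds k x z {d} k∣x-z∣≤d = bound x z k∣x-z∣≤d , bound z x (subst (λ g → k * g ≤ d) (∣-∣-comm x z) k∣x-z∣≤d)
  where
  bound : ∀ x z → k * ∣ x - z ∣ ≤ d → k * x ≤ k * z + d
  bound x z k∣x-z∣≤d =
    ≤-trans (m≤n+∣m-n∣ (k * x) (k * z)) (+-monoʳ-≤ (k * z) (subst (_≤ d) (*-distribˡ-∣-∣ k x z) k∣x-z∣≤d))

gap-cases : ∀ x z → x ≡ z + ∣ x - z ∣ ⊎ z ≡ x + ∣ x - z ∣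
gap-cases x z with ≤-total x z
... | inj₁ x≤z = inj₂ (trans (sym (m+[n∸m]≡n x≤z)) (cong (x +_) (sym (m≤n⇒∣m-n∣≡n∸m x≤z))))
... | inj₂ z≤x = inj₁ (trans (sym (m+[n∸m]≡n z≤x)) (cong (z +_) (sym (m≤n⇒∣n-m∣≡n∸m z≤x))))

averaging-on : ∀ (t : ℕ → ℕ) A N → (∀ j → A ≤ j → j < A + N → 2 * t (2 + j) ≡ t j + t (suc j)) →
  Averaging N (t A) (t (suc A)) (t (A + N)) (t (suc (A + N)))
averaging-on t A zero _ =
  subst₂ (Averaging 0 (t A) (t (suc A))) (cong t (sym (+-identityʳ A))) (cong (t ∘ suc) (sym (+-identityʳ A))) done
averaging-on t A (suc N) average =
  subst₂ (Averaging (suc N) (t A) (t (suc A))) (cong t (sym (+-suc A N))) (cong (t ∘ suc) (sym (+-suc A N)))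
    (step (average A ≤-refl (m<m+n A (s≤s z≤n)))
          (averaging-on t (suc A) N λ j A<j j<A+1+N → average j (<⇒≤ A<j) (subst (j <_) (sym (+-suc A N)) j<A+1+N)))

antitone-on : ∀ (φ : ℕ → ℕ) A N → (∀ j → A ≤ j → j < A + N → φ (suc j) ≤ φ j) → φ (A + N) ≤ φ A
antitone-on φ A zero _ = ≤-reflexive (cong φ (+-identityʳ A))
antitone-on φ A (suc N) φ-step = begin
  φ (A + suc N)   ≡⟨ cong φ (+-suc A N) ⟩
  φ (suc (A + N)) ≤⟨ φ-step (A + N) (m≤m+n A N) (+-monoʳ-< A ≤-refl) ⟩
  φ (A + N)       ≤⟨ antitone-on φ A N (λ j A≤j j<A+N → φ-step j A≤j (<-≤-trans j<A+N (+-monoʳ-≤ A (n≤1+n N)))) ⟩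
  φ A             ∎
  where open ≤-Reasoning

-- The weight across nodes

SmallDivisors : ℕ → ℕ → Set
SmallDivisors p q = (p ≡ 3 × q ≡ 3) ⊎ (p ≡ 3 × q ≡ 5) ⊎ (p ≡ 5 × q ≡ 3)

node-weight-drop : ∀ {u y a b} → 3 * a ≤ u + y → 3 * b ≤ y + a → 18 * (a + 2 * b) ≤ 11 * (u + 2 * y)
node-weight-drop {u} {y} {a} {b} 3a≤u+y 3b≤y+a = ≮⇒≥ refute
  where
  refute : ¬ 11 * (u + 2 * y) < 18 * (a + 2 * b)
  refute 11[u+2y]<18[a+2b] =
    infeasible u (10 ⊛ 3a≤u+y ⊕ 12 ⊛ 3b≤y+a ⊕ 11[u+2y]<18[a+2b]) (solve (u ∷ y ∷ a ∷ b ∷ []))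

first-run-weight : ∀ {n} u y {u₁ y₁} → Averaging n (u + y) (y + (u + y)) u₁ y₁ → u₁ + 2 * y₁ ≡ 3 * u + 5 * y
first-run-weight u y run = trans (sym (averaging-weight run)) (solve (u ∷ y ∷ []))

weight-gain : ∀ u {y} → 1 ≤ y → u + 2 * y < 3 * u + 5 * y
weight-gain u {y} 1≤y = ≰⇒> refute
  where
  refute : ¬ 3 * u + 5 * y ≤ u + 2 * y
  refute 3u+5y≤u+2y = infeasible (2 * u + 2 * y) (3u+5y≤u+2y ⊕ 1≤y) (solve (u ∷ y ∷ []))

divisors-before-third-node : ∀ {n u y u₁ y₁ a b p q} → 1 ≤ u → Averaging n (u + y) (y + (u + y)) u₁ y₁ →
  a * p ≡ u₁ + y₁ → b * q ≡ y₁ + a → 3 ≤ p → 3 ≤ q → 18 * (u + 2 * y) ≤ 11 * (a + 2 * b) → p ≡ 3 × q ≡ 3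
divisors-before-third-node {u = u} {y} {u₁} {y₁} {a} {b} {p} {q} u≥1 run ap≡u₁+y₁ bq≡y₁+a 3≤p 3≤q weight-drop
  with p ≟ 3 | q ≟ 3
... | yes p≡3 | yes q≡3 = p≡3 , q≡3
... | no p≢3 | _ = ⊥-elim (infeasible (33 * u₁ + 149 * y + 2)
  (110 ⊛ quotient-bound a 4≤p ap≡u₁+y₁ ⊕ 176 ⊛ quotient-bound b 3≤q bq≡y₁+a ⊕ 24 ⊛ weight-drop
   ⊕ 143 ⊛ ≤-reflexive (first-run-weight u y run) ⊕ 3 ⊛ u≥1)
  (solve (u ∷ y ∷ u₁ ∷ y₁ ∷ a ∷ b ∷ [])))
  where
  4≤p : 4 ≤ p
  4≤p = ≤∧≢⇒< 3≤p λ 3≡p → p≢3 (sym 3≡p)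
... | yes _ | no q≢3 = ⊥-elim (infeasible (17 * y + 2)
  (11 ⊛ quotient-bound a 3≤p ap≡u₁+y₁ ⊕ 11 ⊛ quotient-bound b 4≤q bq≡y₁+a ⊕ 2 ⊛ weight-drop
   ⊕ 11 ⊛ ≤-reflexive (first-run-weight u y run) ⊕ 3 ⊛ u≥1)
  (solve (u ∷ y ∷ u₁ ∷ y₁ ∷ a ∷ b ∷ [])))
  where
  4≤q : 4 ≤ q
  4≤q = ≤∧≢⇒< 3≤q λ 3≡q → q≢3 (sym 3≡q)

-- A cycle with exactly two nodes: the pair (u, y) is followed by the exceptional node (u + y, y + (u + y)),
-- whose run ends in (u₁, y₁); then comes the node (a, b), whose run returns to (u, y).
module TwoNodeLoop {n₁ n₂ u y u₁ y₁ a b : ℕ}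
  (u≥1 : 1 ≤ u) (u+y-prime : Prime (u + y)) (not-1-2 : ¬ (u ≡ 1 × y ≡ 2))
  (run₁ : Averaging (suc n₁) (u + y) (y + (u + y)) u₁ y₁) (run₂ : Averaging (suc n₂) a b u y) where

  weight₁ : u₁ + 2 * y₁ ≡ 3 * u + 5 * y
  weight₁ = first-run-weight u y run₁

  weight₂ : u + 2 * y ≡ a + 2 * b
  weight₂ = sym (averaging-weight run₂)

  first-run-spread : ∀ k → k * ∣ y₁ - u₁ ∣ ≤ ∣ y + (u + y) - (u + y) ∣ → k * y₁ ≤ k * u₁ + y × k * u₁ ≤ k * y₁ + y
  first-run-spread k bound = gap-bounds k y₁ u₁ (subst (k * ∣ y₁ - u₁ ∣ ≤_) gap₀≡y bound)
    where
    gap₀≡y : ∣ y + (u + y) - (u + y) ∣ ≡ y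
    gap₀≡y = trans (cong (λ b₀ → ∣ b₀ - (u + y) ∣) (+-comm y (u + y)))
                   (trans (∣-∣-comm (u + y + y) (u + y)) (∣m-m+n∣≡n (u + y) y))

  2y₁≤2u₁+y : 2 * y₁ ≤ 2 * u₁ + y
  2y₁≤2u₁+y = proj₁ (first-run-spread 2 (averaging-gap-≤ (s≤s z≤n) run₁))

  2u₁≤2y₁+y : 2 * u₁ ≤ 2 * y₁ + y
  2u₁≤2y₁+y = proj₂ (first-run-spread 2 (averaging-gap-≤ (s≤s z≤n) run₁))

  no-divisors-≥5-≥5 : 5 * a ≤ u₁ + y₁ → 5 * b ≤ y₁ + a → ⊥
  no-divisors-≥5-≥5 5a≤u₁+y₁ 5b≤y₁+a = infeasible (19 * y + 1)
    (16 ⊛ ≤-reflexive weight₁ ⊕ 50 ⊛ ≤-reflexive weight₂ ⊕ 2y₁≤2u₁+y ⊕ 2 ⊛ u≥1 ⊕ 14 ⊛ 5a≤u₁+y₁ ⊕ 20 ⊛ 5b≤y₁+a)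
    (solve (u ∷ y ∷ u₁ ∷ y₁ ∷ a ∷ b ∷ []))

  no-divisors-3-≥11 : a * 3 ≡ u₁ + y₁ → 11 * b ≤ y₁ + a → ⊥
  no-divisors-3-≥11 3a≡u₁+y₁ 11b≤y₁+a = infeasible (69 * y + 5)
    (64 ⊛ ≤-reflexive weight₁ ⊕ 198 ⊛ ≤-reflexive weight₂ ⊕ 7 ⊛ 2u₁≤2y₁+y ⊕ 6 ⊛ u≥1
     ⊕ 78 ⊛ ≤-reflexive 3a≡u₁+y₁ ⊕ 36 ⊛ 11b≤y₁+a)
    (solve (u ∷ y ∷ u₁ ∷ y₁ ∷ a ∷ b ∷ []))

  no-divisors-≥11-3 : 11 * a ≤ u₁ + y₁ → b * 3 ≡ y₁ + a → ⊥
  no-divisors-≥11-3 11a≤u₁+y₁ 3b≡y₁+a = infeasible (59 * y + 5)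
    (64 ⊛ ≤-reflexive weight₁ ⊕ 198 ⊛ ≤-reflexive weight₂ ⊕ 17 ⊛ 2y₁≤2u₁+y ⊕ 6 ⊛ u≥1 ⊕ 30 ⊛ 11a≤u₁+y₁
     ⊕ 132 ⊛ ≤-reflexive 3b≡y₁+a)
    (solve (u ∷ y ∷ u₁ ∷ y₁ ∷ a ∷ b ∷ []))

  -- Two one-step runs force (u, y) = (7, 6), hence u₁ + y₁ = 35; all other configurations are infeasible.
  module Divisors-7-3 (7a≡u₁+y₁ : a * 7 ≡ u₁ + y₁) (3b≡y₁+a : b * 3 ≡ y₁ + a)
    (7-least : ∀ r → Prime r → r ∣ u₁ + y₁ → 7 ≤ r) where

    refute-long-return : AveragingView (u + y) (y + (u + y)) u₁ y₁ → ∀ d → b ≡ a + d ⊎ a ≡ b + d →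
                  8 * y ≤ 8 * u + d × 8 * u ≤ 8 * y + d → ⊥
    refute-long-return (one-step _ 2y₁≡a₀+b₀) d (inj₁ b≡a+d) (_ , 8u≤8y+d) = infeasible 5
      (81 ⊛ ≤-reflexive weight₁ ⊕ 343 ⊛ ≤-reflexive weight₂ ⊕ 6 ⊛ u≥1 ⊕ 81 ⊛ ≤-reflexive 7a≡u₁+y₁
       ⊕ 231 ⊛ ≤-reflexive 3b≡y₁+a ⊕ 75 ⊛ ≤-reflexive 2y₁≡a₀+b₀ ⊕ 7 ⊛ ≥-reflexive b≡a+d ⊕ 7 ⊛ 8u≤8y+d)
      (solve (u ∷ y ∷ u₁ ∷ y₁ ∷ a ∷ b ∷ d ∷ []))
    refute-long-return (one-step u₁≡b₀ _) d (inj₂ a≡b+d) _ = infeasible (7 * d + 1)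
      (4 ⊛ ≥-reflexive weight₁ ⊕ 7 ⊛ ≥-reflexive weight₂ ⊕ 2 ⊛ u≥1 ⊕ ≥-reflexive 7a≡u₁+y₁
       ⊕ 7 ⊛ ≥-reflexive 3b≡y₁+a ⊕ 3 ⊛ ≤-reflexive u₁≡b₀ ⊕ 7 ⊛ ≥-reflexive a≡b+d)
      (solve (u ∷ y ∷ u₁ ∷ y₁ ∷ a ∷ b ∷ d ∷ []))
    refute-long-return (two-steps c 2c≡a₀+b₀ u₁≡c _) d (inj₁ b≡a+d) (8y≤8u+d , _) = infeasible 51
      (293 ⊛ ≥-reflexive weight₁ ⊕ 649 ⊛ ≥-reflexive weight₂ ⊕ 52 ⊛ u≥1 ⊕ 155 ⊛ ≥-reflexive 7a≡u₁+y₁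
       ⊕ 431 ⊛ ≥-reflexive 3b≡y₁+a ⊕ 69 ⊛ ≤-reflexive 2c≡a₀+b₀ ⊕ 138 ⊛ ≤-reflexive u₁≡c
       ⊕ 5 ⊛ ≥-reflexive b≡a+d ⊕ 5 ⊛ 8y≤8u+d)
      (solve (u ∷ y ∷ u₁ ∷ y₁ ∷ a ∷ b ∷ c ∷ d ∷ []))
    refute-long-return (two-steps c 2c≡a₀+b₀ u₁≡c _) d (inj₂ a≡b+d) _ = infeasible (5 * d + 3)
      (11 ⊛ ≥-reflexive weight₁ ⊕ 23 ⊛ ≥-reflexive weight₂ ⊕ 4 ⊛ u≥1 ⊕ 5 ⊛ ≥-reflexive 7a≡u₁+y₁
       ⊕ 17 ⊛ ≥-reflexive 3b≡y₁+a ⊕ 3 ⊛ ≤-reflexive 2c≡a₀+b₀ ⊕ 6 ⊛ ≤-reflexive u₁≡c ⊕ 5 ⊛ ≥-reflexive a≡b+d)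
      (solve (u ∷ y ∷ u₁ ∷ y₁ ∷ a ∷ b ∷ c ∷ d ∷ []))
    refute-long-return (three-or-more gap₁) d (inj₁ b≡a+d) (8y≤8u+d , _) = infeasible 31
      (497 ⊛ ≥-reflexive weight₁ ⊕ 1307 ⊛ ≥-reflexive weight₂ ⊕ 32 ⊛ u≥1 ⊕ 313 ⊛ ≥-reflexive 7a≡u₁+y₁
       ⊕ 865 ⊛ ≥-reflexive 3b≡y₁+a ⊕ 23 ⊛ proj₂ (first-run-spread 8 gap₁) ⊕ 19 ⊛ ≥-reflexive b≡a+d
       ⊕ 19 ⊛ 8y≤8u+d)
      (solve (u ∷ y ∷ u₁ ∷ y₁ ∷ a ∷ b ∷ d ∷ []))
    refute-long-return (three-or-more gap₁) d (inj₂ a≡b+d) _ = infeasible (19 * d + 7)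
      (15 ⊛ ≥-reflexive weight₁ ⊕ 37 ⊛ ≥-reflexive weight₂ ⊕ 8 ⊛ u≥1 ⊕ 7 ⊛ ≥-reflexive 7a≡u₁+y₁
       ⊕ 31 ⊛ ≥-reflexive 3b≡y₁+a ⊕ proj₂ (first-run-spread 8 gap₁) ⊕ 19 ⊛ ≥-reflexive a≡b+d)
      (solve (u ∷ y ∷ u₁ ∷ y₁ ∷ a ∷ b ∷ d ∷ []))

    refute : AveragingView (u + y) (y + (u + y)) u₁ y₁ → AveragingView a b u y → ⊥
    refute (one-step u₁≡b₀ 2y₁≡a₀+b₀) (one-step u≡b 2y≡a+b) =
      from-no (7 ≤? 5) (7-least 5 (from-yes (prime? 5)) (divides 7 u₁+y₁≡35))
      where
      6u≡7y : 6 * u ≡ 7 * y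
      6u≡7y = sym (linear-consequence 2 (7 * y) (6 * u)
        (u₁≡b₀ ⊕₌ 4 ⊛₌ 2y₁≡a₀+b₀ ⊕₌ 21 ⊛₌ u≡b ⊕₌ 7a≡u₁+y₁ ⊕₌ 7 ⊛₌ 3b≡y₁+a)
        (solve (u ∷ y ∷ u₁ ∷ y₁ ∷ a ∷ b ∷ [])))
      u≡7×y≡6 : u ≡ 7 × y ≡ 6
      u≡7×y≡6 = proportional-prime-sum 7 6 (from-yes (coprime? 7 6)) 6u≡7y u+y-prime
      at-7-6 : ∀ (f : ℕ → ℕ → ℕ) → f u y ≡ f 7 6
      at-7-6 f = cong₂ f (proj₁ u≡7×y≡6) (proj₂ u≡7×y≡6)
      u₁+y₁≡35 : u₁ + y₁ ≡ 35
      u₁+y₁≡35 = cong₂ _+_ (trans u₁≡b₀ (at-7-6 λ u y → y + (u + y)))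
                           (*-cancelˡ-≡ y₁ 16 2 (trans 2y₁≡a₀+b₀ (at-7-6 λ u y → u + y + (y + (u + y)))))
    refute (one-step _ 2y₁≡a₀+b₀) (two-steps c′ 2c′≡a+b u≡c′ _) = infeasible 1
      (13 ⊛ ≤-reflexive weight₁ ⊕ 49 ⊛ ≤-reflexive weight₂ ⊕ 2 ⊛ u≥1 ⊕ 13 ⊛ ≤-reflexive 7a≡u₁+y₁
       ⊕ 35 ⊛ ≤-reflexive 3b≡y₁+a ⊕ 11 ⊛ ≤-reflexive 2y₁≡a₀+b₀ ⊕ 7 ⊛ ≤-reflexive 2c′≡a+b
       ⊕ 14 ⊛ ≤-reflexive u≡c′)
      (solve (u ∷ y ∷ u₁ ∷ y₁ ∷ a ∷ b ∷ c′ ∷ []))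
    refute (two-steps c 2c≡a₀+b₀ u₁≡c _) (one-step _ 2y≡a+b) = infeasible 5
      (29 ⊛ ≥-reflexive weight₁ ⊕ 67 ⊛ ≥-reflexive weight₂ ⊕ 6 ⊛ u≥1 ⊕ 15 ⊛ ≥-reflexive 7a≡u₁+y₁
       ⊕ 43 ⊛ ≥-reflexive 3b≡y₁+a ⊕ 7 ⊛ ≤-reflexive 2c≡a₀+b₀ ⊕ 14 ⊛ ≤-reflexive u₁≡c ⊕ 5 ⊛ ≤-reflexive 2y≡a+b)
      (solve (u ∷ y ∷ u₁ ∷ y₁ ∷ a ∷ b ∷ c ∷ []))
    refute (two-steps c 2c≡a₀+b₀ u₁≡c _) (two-steps c′ 2c′≡a+b _ 2y≡b+c′) = infeasible 7
      (47 ⊛ ≥-reflexive weight₁ ⊕ 111 ⊛ ≥-reflexive weight₂ ⊕ 8 ⊛ u≥1 ⊕ 25 ⊛ ≥-reflexive 7a≡u₁+y₁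
       ⊕ 69 ⊛ ≥-reflexive 3b≡y₁+a ⊕ 11 ⊛ ≤-reflexive 2c≡a₀+b₀ ⊕ 22 ⊛ ≤-reflexive u₁≡c
       ⊕ 5 ⊛ ≤-reflexive 2c′≡a+b ⊕ 10 ⊛ ≤-reflexive 2y≡b+c′)
      (solve (u ∷ y ∷ u₁ ∷ y₁ ∷ a ∷ b ∷ c ∷ c′ ∷ []))
    refute (three-or-more gap₁) (one-step _ 2y≡a+b) = infeasible 17
      (143 ⊛ ≥-reflexive weight₁ ⊕ 411 ⊛ ≥-reflexive weight₂ ⊕ 18 ⊛ u≥1 ⊕ 87 ⊛ ≥-reflexive 7a≡u₁+y₁
       ⊕ 255 ⊛ ≥-reflexive 3b≡y₁+a ⊕ 7 ⊛ proj₂ (first-run-spread 8 gap₁) ⊕ 57 ⊛ ≤-reflexive 2y≡a+b)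
      (solve (u ∷ y ∷ u₁ ∷ y₁ ∷ a ∷ b ∷ []))
    refute (three-or-more gap₁) (two-steps c′ 2c′≡a+b _ 2y≡b+c′) = infeasible 11
      (241 ⊛ ≥-reflexive weight₁ ⊕ 711 ⊛ ≥-reflexive weight₂ ⊕ 12 ⊛ u≥1 ⊕ 153 ⊛ ≥-reflexive 7a≡u₁+y₁
       ⊕ 417 ⊛ ≥-reflexive 3b≡y₁+a ⊕ 11 ⊛ proj₂ (first-run-spread 8 gap₁) ⊕ 57 ⊛ ≤-reflexive 2c′≡a+b
       ⊕ 114 ⊛ ≤-reflexive 2y≡b+c′)
      (solve (u ∷ y ∷ u₁ ∷ y₁ ∷ a ∷ b ∷ c′ ∷ []))
    refute run₁-view (three-or-more gap₂) =
      refute-long-return run₁-view ∣ b - a ∣ (gap-cases b a) (gap-bounds 8 y u gap₂)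

  no-divisors-7-3 : a * 7 ≡ u₁ + y₁ → b * 3 ≡ y₁ + a → IsSmallestPrimeFactor 7 (u₁ + y₁) → ⊥
  no-divisors-7-3 7a≡u₁+y₁ 3b≡y₁+a (_ , _ , 7-least) =
    Divisors-7-3.refute 7a≡u₁+y₁ 3b≡y₁+a 7-least (averaging-view run₁) (averaging-view run₂)

  module Divisors-3-7 (3a≡u₁+y₁ : a * 3 ≡ u₁ + y₁) (7b≡y₁+a : b * 7 ≡ y₁ + a) where

    b≥a-impossible : ∀ d → b ≡ a + d → ⊥
    b≥a-impossible d b≡a+d = infeasible (3 * d + u₁)
      (2 ⊛ ≥-reflexive weight₁ ⊕ 5 ⊛ ≥-reflexive weight₂ ⊕ u≥1 ⊕ 3 ⊛ ≥-reflexive 3a≡u₁+y₁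
       ⊕ ≥-reflexive 7b≡y₁+a ⊕ 3 ⊛ ≥-reflexive b≡a+d)
      (solve (u ∷ y ∷ u₁ ∷ y₁ ∷ a ∷ b ∷ d ∷ []))

    refute-long-return : AveragingView (u + y) (y + (u + y)) u₁ y₁ → ∀ d → a ≡ b + d → 8 * y ≤ 8 * u + d → ⊥
    refute-long-return (one-step _ 2y₁≡a₀+b₀) d a≡b+d 8y≤8u+d = infeasible 5
      (43 ⊛ ≥-reflexive weight₁ ⊕ 101 ⊛ ≥-reflexive weight₂ ⊕ 6 ⊛ u≥1 ⊕ 43 ⊛ ≥-reflexive 3a≡u₁+y₁
       ⊕ 29 ⊛ ≥-reflexive 7b≡y₁+a ⊕ 7 ⊛ ≤-reflexive 2y₁≡a₀+b₀ ⊕ ≥-reflexive a≡b+d ⊕ 8y≤8u+d)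
      (solve (u ∷ y ∷ u₁ ∷ y₁ ∷ a ∷ b ∷ d ∷ []))
    refute-long-return (two-steps c 2c≡a₀+b₀ _ 2y₁≡b₀+c) d a≡b+d 8y≤8u+d = infeasible 3
      (87 ⊛ ≥-reflexive weight₁ ⊕ 205 ⊛ ≥-reflexive weight₂ ⊕ 4 ⊛ u≥1 ⊕ 87 ⊛ ≥-reflexive 3a≡u₁+y₁
       ⊕ 59 ⊛ ≥-reflexive 7b≡y₁+a ⊕ 7 ⊛ ≤-reflexive 2c≡a₀+b₀ ⊕ 14 ⊛ ≤-reflexive 2y₁≡b₀+c
       ⊕ 3 ⊛ ≥-reflexive a≡b+d ⊕ 3 ⊛ 8y≤8u+d)
      (solve (u ∷ y ∷ u₁ ∷ y₁ ∷ a ∷ b ∷ c ∷ d ∷ []))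
    refute-long-return (three-or-more gap₁) d a≡b+d 8y≤8u+d = infeasible 31
      (465 ⊛ ≥-reflexive weight₁ ⊕ 1227 ⊛ ≥-reflexive weight₂ ⊕ 32 ⊛ u≥1 ⊕ 521 ⊛ ≥-reflexive 3a≡u₁+y₁
       ⊕ 353 ⊛ ≥-reflexive 7b≡y₁+a ⊕ 7 ⊛ proj₁ (first-run-spread 8 gap₁) ⊕ 17 ⊛ ≥-reflexive a≡b+d
       ⊕ 17 ⊛ 8y≤8u+d)
      (solve (u ∷ y ∷ u₁ ∷ y₁ ∷ a ∷ b ∷ d ∷ []))

    refute : AveragingView (u + y) (y + (u + y)) u₁ y₁ → AveragingView a b u y → ⊥
    refute (one-step u₁≡b₀ 2y₁≡a₀+b₀) (one-step _ 2y≡a+b) =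
      not-1-2 (proportional-prime-sum 1 2 (from-yes (coprime? 1 2)) 2u≡y u+y-prime)
      where
      2u≡y : 2 * u ≡ 1 * y
      2u≡y = linear-consequence 19 (2 * u) (1 * y)
        (16 ⊛₌ u₁≡b₀ ⊕₌ 11 ⊛₌ 2y₁≡a₀+b₀ ⊕₌ 42 ⊛₌ 2y≡a+b ⊕₌ 16 ⊛₌ 3a≡u₁+y₁ ⊕₌ 6 ⊛₌ 7b≡y₁+a)
        (solve (u ∷ y ∷ u₁ ∷ y₁ ∷ a ∷ b ∷ []))
    refute (one-step _ 2y₁≡a₀+b₀) (two-steps c′ 2c′≡a+b _ 2y≡b+c′) = infeasible 5
      (29 ⊛ ≥-reflexive weight₁ ⊕ 71 ⊛ ≥-reflexive weight₂ ⊕ 6 ⊛ u≥1 ⊕ 29 ⊛ ≥-reflexive 3a≡u₁+y₁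
       ⊕ 19 ⊛ ≥-reflexive 7b≡y₁+a ⊕ 5 ⊛ ≤-reflexive 2y₁≡a₀+b₀ ⊕ 3 ⊛ ≤-reflexive 2c′≡a+b
       ⊕ 6 ⊛ ≤-reflexive 2y≡b+c′)
      (solve (u ∷ y ∷ u₁ ∷ y₁ ∷ a ∷ b ∷ c′ ∷ []))
    refute (two-steps c 2c≡a₀+b₀ u₁≡c _) (one-step u≡b _) = infeasible 1
      (13 ⊛ ≤-reflexive weight₁ ⊕ 34 ⊛ ≤-reflexive weight₂ ⊕ 2 ⊛ u≥1 ⊕ 15 ⊛ ≤-reflexive 3a≡u₁+y₁
       ⊕ 11 ⊛ ≤-reflexive 7b≡y₁+a ⊕ ≤-reflexive 2c≡a₀+b₀ ⊕ 2 ⊛ ≤-reflexive u₁≡c ⊕ 9 ⊛ ≤-reflexive u≡b)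
      (solve (u ∷ y ∷ u₁ ∷ y₁ ∷ a ∷ b ∷ c ∷ []))
    refute (two-steps c 2c≡a₀+b₀ _ 2y₁≡b₀+c) (two-steps c′ 2c′≡a+b _ 2y≡b+c′) = infeasible 7
      (57 ⊛ ≥-reflexive weight₁ ⊕ 143 ⊛ ≥-reflexive weight₂ ⊕ 8 ⊛ u≥1 ⊕ 57 ⊛ ≥-reflexive 3a≡u₁+y₁
       ⊕ 37 ⊛ ≥-reflexive 7b≡y₁+a ⊕ 5 ⊛ ≤-reflexive 2c≡a₀+b₀ ⊕ 10 ⊛ ≤-reflexive 2y₁≡b₀+c
       ⊕ 9 ⊛ ≤-reflexive 2c′≡a+b ⊕ 18 ⊛ ≤-reflexive 2y≡b+c′)
      (solve (u ∷ y ∷ u₁ ∷ y₁ ∷ a ∷ b ∷ c ∷ c′ ∷ []))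
    refute (three-or-more gap₁) (one-step u≡b _) = infeasible 5
      (79 ⊛ ≤-reflexive weight₁ ⊕ 198 ⊛ ≤-reflexive weight₂ ⊕ 6 ⊛ u≥1 ⊕ 87 ⊛ ≤-reflexive 3a≡u₁+y₁
       ⊕ 63 ⊛ ≤-reflexive 7b≡y₁+a ⊕ proj₂ (first-run-spread 8 gap₁) ⊕ 45 ⊛ ≤-reflexive u≡b)
      (solve (u ∷ y ∷ u₁ ∷ y₁ ∷ a ∷ b ∷ []))
    refute (three-or-more gap₁) (two-steps c′ 2c′≡a+b _ 2y≡b+c′) = infeasible 51
      (303 ⊛ ≥-reflexive weight₁ ⊕ 857 ⊛ ≥-reflexive weight₂ ⊕ 52 ⊛ u≥1 ⊕ 343 ⊛ ≥-reflexive 3a≡u₁+y₁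
       ⊕ 223 ⊛ ≥-reflexive 7b≡y₁+a ⊕ 5 ⊛ proj₁ (first-run-spread 8 gap₁) ⊕ 51 ⊛ ≤-reflexive 2c′≡a+b
       ⊕ 102 ⊛ ≤-reflexive 2y≡b+c′)
      (solve (u ∷ y ∷ u₁ ∷ y₁ ∷ a ∷ b ∷ c′ ∷ []))
    refute run₁-view (three-or-more gap₂) with gap-cases b a
    ... | inj₁ b≡a+d = b≥a-impossible ∣ b - a ∣ b≡a+d
    ... | inj₂ a≡b+d = refute-long-return run₁-view ∣ b - a ∣ a≡b+d (proj₁ (gap-bounds 8 y u gap₂))

  no-divisors-3-7 : a * 3 ≡ u₁ + y₁ → b * 7 ≡ y₁ + a → ⊥
  no-divisors-3-7 3a≡u₁+y₁ 7b≡y₁+a =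
    Divisors-3-7.refute 3a≡u₁+y₁ 7b≡y₁+a (averaging-view run₁) (averaging-view run₂)

  divisors : ∀ {p q} → IsSmallestPrimeFactor p (u₁ + y₁) → IsSmallestPrimeFactor q (y₁ + a) →
             a * p ≡ u₁ + y₁ → b * q ≡ y₁ + a → 3 ≤ p → 3 ≤ q → SmallDivisors p q
  divisors spf-p spf-q ap≡u₁+y₁ bq≡y₁+a 3≤p 3≤q
    with odd-prime-cases (proj₁ spf-p) 3≤p | odd-prime-cases (proj₁ spf-q) 3≤q
  ... | inj₁ refl | inj₁ refl = inj₁ (refl , refl)
  ... | inj₁ refl | inj₂ (inj₁ refl) = inj₂ (inj₁ (refl , refl))
  ... | inj₂ (inj₁ refl) | inj₁ refl = inj₂ (inj₂ (refl , refl))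
  ... | inj₁ refl | inj₂ (inj₂ (inj₁ refl)) = ⊥-elim (no-divisors-3-7 ap≡u₁+y₁ bq≡y₁+a)
  ... | inj₂ (inj₂ (inj₁ refl)) | inj₁ refl = ⊥-elim (no-divisors-7-3 ap≡u₁+y₁ bq≡y₁+a spf-p)
  ... | inj₁ refl | inj₂ (inj₂ (inj₂ 11≤q)) = ⊥-elim (no-divisors-3-≥11 ap≡u₁+y₁ (quotient-bound b 11≤q bq≡y₁+a))
  ... | inj₂ (inj₂ (inj₂ 11≤p)) | inj₁ refl = ⊥-elim (no-divisors-≥11-3 (quotient-bound a 11≤p ap≡u₁+y₁) bq≡y₁+a)
  ... | inj₂ p≥5 | inj₂ q≥5 =
    ⊥-elim (no-divisors-≥5-≥5 (quotient-bound a (5≤ p≥5) ap≡u₁+y₁) (quotient-bound b (5≤ q≥5) bq≡y₁+a))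
    where
    5≤ : ∀ {r} → r ≡ 5 ⊎ r ≡ 7 ⊎ 11 ≤ r → 5 ≤ r
    5≤ (inj₁ refl) = ≤-refl
    5≤ (inj₂ (inj₁ refl)) = from-yes (5 ≤? 7)
    5≤ (inj₂ (inj₂ 11≤r)) = ≤-trans (from-yes (5 ≤? 11)) 11≤r

-- The cycle

first-in-range : ∀ {P : ℕ → Set} → (∀ j → Dec (P j)) → ∀ A N →
  (∀ i → i < N → ¬ P (A + i)) ⊎ Σ ℕ (λ i → i < N × P (A + i) × (∀ i′ → i′ < i → ¬ P (A + i′)))
first-in-range P? A zero = inj₁ λ _ ()
first-in-range {P} P? A (suc N) with first-in-range P? A N
... | inj₂ (i , i<N , P[A+i] , before) = inj₂ (i , m<n⇒m<1+n i<N , P[A+i] , before)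
... | inj₁ none with P? (A + N)
...   | yes P[A+N] = inj₂ (N , ≤-refl , P[A+N] , none)
...   | no ¬P[A+N] = inj₁ none′
  where
  none′ : ∀ i → i < suc N → ¬ P (A + i)
  none′ i i<1+N with m≤n⇒m<n∨m≡n (s≤s⁻¹ i<1+N)
  ... | inj₁ i<N = none i i<N
  ... | inj₂ refl = ¬P[A+N]

div-exact : ∀ {z d s} → 0 < z → z * d ≡ s → div s z ≡ d
div-exact {suc z} {d} _ refl = trans (cong (_/ suc z) (*-comm (suc z) d)) (m*n/n≡m d (suc z))

module CycleProperties {m : ℕ} {t : ℕ → ℕ} (cycle : NontrivialCycle m t) where
  open NontrivialCycle cycle

  sum : ℕ → ℕ
  sum j = t j + t (suc j)

  weight : ℕ → ℕ
  weight j = t j + 2 * t (suc j)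

  t-periodic : ∀ k i → t (i + k * m) ≡ t i
  t-periodic zero i = cong t (+-identityʳ i)
  t-periodic (suc k) i = trans (cong t (sym (+-assoc i m (k * m)))) (trans (t-periodic k (i + m)) (periodic i))

  record Division (j : ℕ) : Set where
    field
      divisor    : ℕ
      quotient   : t (2 + j) * divisor ≡ sum j
      signature  : sig t (2 + j) ≡ divisor
      prime-or-spf : (divisor ≡ 1 × Prime (sum j)) ⊎ IsSmallestPrimeFactor divisor (sum j)

  division : ∀ j → Division j
  division j with rule j
  ... | inj₁ (sum-prime , next≡sum) = record
    { divisor = 1 ; quotient = quotient ; signature = div-exact (positive (2 + j)) quotient
    ; prime-or-spf = inj₁ (refl , sum-prime) }
    where
    quotient : t (2 + j) * 1 ≡ sum j
    quotient = trans (*-identityʳ (t (2 + j))) next≡sum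
  ... | inj₂ (_ , p , spf , quotient) = record
    { divisor = p ; quotient = quotient ; signature = div-exact (positive (2 + j)) quotient
    ; prime-or-spf = inj₂ spf }

  signature-one : ∀ j → sig t (2 + j) ≡ 1 → t (2 + j) ≡ sum j × Prime (sum j)
  signature-one j sig≡1 with division j
  ... | record { quotient = quotient ; prime-or-spf = inj₁ (refl , sum-prime) } =
    trans (sym (*-identityʳ (t (2 + j)))) quotient , sum-prime
  ... | record { signature = sig≡p ; prime-or-spf = inj₂ (p-prime , _) } =
    ⊥-elim (<-irrefl refl (subst (2 ≤_) (trans (sym sig≡p) sig≡1) (prime⇒2≤ p-prime)))

  next-of-prime-sum : ∀ j {s} → sum j ≡ s → Prime s → t (2 + j) ≡ s
  next-of-prime-sum j sum≡s s-prime with rule j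
  ... | inj₁ (_ , next≡sum) = trans next≡sum sum≡s
  ... | inj₂ (composite , _) = ⊥-elim (prime⇒¬composite s-prime (subst Composite sum≡s composite))

  next-of-composite-sum : ∀ j {s d} → sum j ≡ s → ¬ Prime s → (∀ p → IsSmallestPrimeFactor p s → p ≡ d) →
    t (2 + j) * d ≡ s
  next-of-composite-sum j {s} sum≡s ¬prime spf≡d with division j
  ... | record { prime-or-spf = inj₁ (_ , sum-prime) } = ⊥-elim (¬prime (subst Prime sum≡s sum-prime))
  ... | record { divisor = p ; quotient = quotient ; prime-or-spf = inj₂ spf } =
    trans (cong (t (2 + j) *_) (sym (spf≡d p (subst (IsSmallestPrimeFactor p) sum≡s spf)))) (trans quotient sum≡s)

  nodeP≡sig : ∀ e → nodeP t e ≡ sig t (suc e)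
  nodeP≡sig e = cong (sig t) (+-comm e 1)

  nodeQ≡sig : ∀ e → nodeQ t e ≡ sig t (2 + e)
  nodeQ≡sig e = cong (sig t) (+-comm e 2)

  sig-periodic : ∀ k j → sig t (2 + (j + k * m)) ≡ sig t (2 + j)
  sig-periodic k j = cong₂ div (cong₂ _+_ (t-periodic k j) (t-periodic k (suc j))) (t-periodic k (2 + j))

  node-periodic : ∀ k g → nodeP t (suc g + k * m) ≡ nodeP t (suc g) × nodeQ t (suc g + k * m) ≡ nodeQ t (suc g)
  node-periodic k g = trans (nodeP≡sig _) (trans (sig-periodic k g) (sym (nodeP≡sig (suc g))))
                    , trans (nodeQ≡sig _) (trans (sig-periodic k (suc g)) (sym (nodeQ≡sig (suc g))))

  weight-step : ∀ j → 2 ≤ Division.divisor (division j) → weight (suc j) ≤ weight j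
  weight-step j 2≤d = begin
    t (suc j) + 2 * t (2 + j)          ≤⟨ +-monoʳ-≤ (t (suc j)) (*-monoˡ-≤ (t (2 + j)) 2≤d) ⟩
    t (suc j) + divisor * t (2 + j)    ≡⟨ cong (t (suc j) +_) (trans (*-comm divisor (t (2 + j))) quotient) ⟩
    t (suc j) + (t j + t (suc j))      ≡⟨ weight-shift (t j) (t (suc j)) ⟩
    t j + 2 * t (suc j)                ∎
    where
    open ≤-Reasoning
    open Division (division j)

-- The exceptional node sits at e₀ = suc f, so u = t f and y = t (suc f).
module AfterExceptionalNode {m : ℕ} {t : ℕ → ℕ} (cycle : NontrivialCycle m t) (f : ℕ)
  (even₀ : Even (t (suc f))) (p₀≡1 : nodeP t (suc f) ≡ 1) (q₀≡1 : nodeQ t (suc f) ≡ 1)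
  (other-nodes : ∀ e → 1 ≤ e → e ≤ m → Even (t e) → e ≢ suc f → nodeP t e ≢ 1 × nodeQ t e ≢ 1) where

  open NontrivialCycle cycle
  open CycleProperties cycle

  instance
    m-nonZero : NonZero m
    m-nonZero = >-nonZero (proj₁ minimal)

  Exceptional : ℕ → Set
  Exceptional e = Σ ℕ λ k → e ≡ suc f + k * m

  inside⇒unexceptional : ∀ {e} → suc f < e → e < suc f + m → ¬ Exceptional e
  inside⇒unexceptional e₀<e e<e₀+m (zero , e≡e₀) = <-irrefl (sym (trans e≡e₀ (+-identityʳ (suc f)))) e₀<e
  inside⇒unexceptional e₀<e e<e₀+m (suc k , e≡) =
    <⇒≱ e<e₀+m (subst (suc f + m ≤_) (sym e≡) (+-monoʳ-≤ (suc f) (m≤m+n m (k * m))))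

  residue : ∀ g → suc g ≡ suc (g % m) + g / m * m
  residue g = cong suc (m≡m%n+[m/n]*n g m)

  residue-node : ∀ g → nodeP t (suc g) ≡ nodeP t (suc (g % m)) × nodeQ t (suc g) ≡ nodeQ t (suc (g % m))
  residue-node g = subst (λ e → nodeP t e ≡ nodeP t (suc (g % m)) × nodeQ t e ≡ nodeQ t (suc (g % m)))
                         (sym (residue g)) (node-periodic (g / m) (g % m))

  node-divisors : ∀ g → Even (t (suc g)) →
    (nodeP t (suc g) ≢ 1 × nodeQ t (suc g) ≢ 1) ⊎ (nodeP t (suc g) ≡ 1 × Exceptional (suc g))
  node-divisors g even with suc (g % m) ≟ suc f
  ... | yes r≡e₀ = inj₂ ( trans (proj₁ (residue-node g)) (trans (cong (nodeP t) r≡e₀) p₀≡1)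
                        , g / m , trans (residue g) (cong (_+ g / m * m) r≡e₀))
  ... | no r≢e₀ = inj₁ ( (λ p≡1 → proj₁ r-divisors (trans (sym (proj₁ (residue-node g))) p≡1))
                       , (λ q≡1 → proj₂ r-divisors (trans (sym (proj₂ (residue-node g))) q≡1)))
    where
    r-divisors : nodeP t (suc (g % m)) ≢ 1 × nodeQ t (suc (g % m)) ≢ 1
    r-divisors = other-nodes (suc (g % m)) (s≤s z≤n) (m%n<n g m)
                   (subst Even (trans (cong t (residue g)) (t-periodic (g / m) (suc (g % m)))) even) r≢e₀

  -- 1, 2 would continue as 3, 5, 4, 3, 7, giving the node at 4 the divisors (3, 1).
  no-1-2 : ∀ j → t j ≡ 1 → t (suc j) ≡ 2 → ⊥
  no-1-2 j t₀≡1 t₁≡2 = refute (node-divisors (3 + j) (subst Even (sym t₄≡4) (divides 2 refl)))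
    where
    t₂≡3 : t (2 + j) ≡ 3
    t₂≡3 = next-of-prime-sum j (cong₂ _+_ t₀≡1 t₁≡2) (from-yes (prime? 3))
    t₃≡5 : t (3 + j) ≡ 5
    t₃≡5 = next-of-prime-sum (1 + j) (cong₂ _+_ t₁≡2 t₂≡3) (from-yes (prime? 5))
    t₄≡4 : t (4 + j) ≡ 4
    t₄≡4 = *-cancelʳ-≡ _ 4 2 (next-of-composite-sum (2 + j) (cong₂ _+_ t₂≡3 t₃≡5) (from-no (prime? 8))
             λ p spf → spf-of-even spf (divides 4 refl))
    t₅≡3 : t (5 + j) ≡ 3
    t₅≡3 = *-cancelʳ-≡ _ 3 3 (next-of-composite-sum (3 + j) (cong₂ _+_ t₃≡5 t₄≡4) (from-no (prime? 9))
             λ p spf → ≤-antisym (proj₂ (proj₂ spf) 3 (from-yes (prime? 3)) (divides 3 refl))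
                                 (spf-of-odd spf (from-no (2 ∣? 9))))
    t₆≡7 : t (6 + j) ≡ 7
    t₆≡7 = next-of-prime-sum (4 + j) (cong₂ _+_ t₄≡4 t₅≡3) (from-yes (prime? 7))
    refute : (nodeP t (4 + j) ≢ 1 × nodeQ t (4 + j) ≢ 1) ⊎ (nodeP t (4 + j) ≡ 1 × Exceptional (4 + j)) → ⊥
    refute (inj₁ (_ , q≢1)) = q≢1 (trans (nodeQ≡sig (4 + j)) (cong₂ div (cong₂ _+_ t₄≡4 t₅≡3) t₆≡7))
    refute (inj₂ (p≡1 , _)) =
      from-no (3 ≟ 1) (trans (sym (trans (nodeP≡sig (4 + j)) (cong₂ div (cong₂ _+_ t₃≡5 t₄≡4) t₅≡3))) p≡1)

  odd-pair⇒composite-sum : ∀ j → Odd (t j) → Odd (t (suc j)) → ¬ Prime (sum j)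
  odd-pair⇒composite-sum j odd₀ odd₁ sum-prime =
    no-1-2 (suc j) (proj₂ ones) (trans (next-of-prime-sum j refl sum-prime) sum≡2)
    where
    sum≡2 : sum j ≡ 2
    sum≡2 = even-prime sum-prime (odd+odd odd₀ odd₁)
    ones : t j ≡ 1 × t (suc j) ≡ 1
    ones = sum≡2⇒ones (positive j) (positive (suc j)) sum≡2

  averaging-step : ∀ j → Odd (t j) → Odd (t (suc j)) → 2 * t (2 + j) ≡ sum j
  averaging-step j odd₀ odd₁ with division j
  ... | record { prime-or-spf = inj₁ (_ , sum-prime) } = ⊥-elim (odd-pair⇒composite-sum j odd₀ odd₁ sum-prime)
  ... | record { quotient = quotient ; prime-or-spf = inj₂ spf } =
    trans (*-comm 2 (t (2 + j))) (subst (λ d → t (2 + j) * d ≡ sum j) (spf-of-even spf (odd+odd odd₀ odd₁)) quotient)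

  unexceptional-node : ∀ g → Even (t (suc g)) → ¬ Exceptional (suc g) → nodeP t (suc g) ≢ 1 × nodeQ t (suc g) ≢ 1
  unexceptional-node g even ¬exceptional with node-divisors g even
  ... | inj₁ divisors≢1 = divisors≢1
  ... | inj₂ (_ , exceptional) = ⊥-elim (¬exceptional exceptional)

  unit-divisor-impossible : ∀ g → ¬ Exceptional (suc g) → ¬ Exceptional (2 + g) →
    sig t (3 + g) ≡ 1 → ¬ Prime (sum (suc g))
  unit-divisor-impossible g ¬exceptional₁ ¬exceptional₂ sig≡1 sum-prime with 2 ∣? t (2 + g) | 2 ∣? t (suc g)
  ... | yes even₂ | _ = proj₁ (unexceptional-node (suc g) even₂ ¬exceptional₂) (trans (nodeP≡sig (2 + g)) sig≡1)
  ... | no _ | yes even₁ = proj₂ (unexceptional-node g even₁ ¬exceptional₁) (trans (nodeQ≡sig (suc g)) sig≡1)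
  ... | no odd₂ | no odd₁ = odd-pair⇒composite-sum (suc g) odd₁ odd₂ sum-prime

  divisor≥2 : ∀ g → ¬ Exceptional (suc g) → ¬ Exceptional (2 + g) → 2 ≤ Division.divisor (division (suc g))
  divisor≥2 g ¬exceptional₁ ¬exceptional₂ with division (suc g)
  ... | record { prime-or-spf = inj₂ (p-prime , _) } = prime⇒2≤ p-prime
  ... | record { signature = sig≡1 ; prime-or-spf = inj₁ (refl , sum-prime) } =
    ⊥-elim (unit-divisor-impossible g ¬exceptional₁ ¬exceptional₂ sig≡1 sum-prime)

  weight-nonincreasing : ∀ j → suc f < j → suc j < suc f + m → weight (suc j) ≤ weight j
  weight-nonincreasing (suc g) e₀<1+g 2+g<e₀+m = weight-step (suc g) (divisor≥2 g
    (inside⇒unexceptional e₀<1+g (<-trans (n<1+n (suc g)) 2+g<e₀+m))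
    (inside⇒unexceptional (<-trans e₀<1+g (n<1+n (suc g))) 2+g<e₀+m))

  spf-divisor : ∀ j → sig t (2 + j) ≢ 1 → IsSmallestPrimeFactor (Division.divisor (division j)) (sum j)
  spf-divisor j sig≢1 with division j
  ... | record { signature = sig≡1 ; prime-or-spf = inj₁ (refl , _) } = ⊥-elim (sig≢1 sig≡1)
  ... | record { prime-or-spf = inj₂ spf } = spf

  record RegularNode (g : ℕ) : Set where
    field
      p q         : ℕ
      p-signature : nodeP t (suc g) ≡ p
      q-signature : nodeQ t (suc g) ≡ q
      p-quotient  : t (2 + g) * p ≡ sum g
      q-quotient  : t (3 + g) * q ≡ sum (suc g)
      p-spf       : IsSmallestPrimeFactor p (sum g)
      q-spf       : IsSmallestPrimeFactor q (sum (suc g))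
      3≤p         : 3 ≤ p
      3≤q         : 3 ≤ q
      a-odd       : Odd (t (2 + g))
      b-odd       : Odd (t (3 + g))

  regular-node : ∀ g → Odd (t g) → Even (t (suc g)) → ¬ Exceptional (suc g) → RegularNode g
  regular-node g odd₀ even₁ ¬exceptional = record
    { p-signature = trans (nodeP≡sig (suc g)) P.signature
    ; q-signature = trans (nodeQ≡sig (suc g)) Q.signature
    ; p-quotient  = P.quotient
    ; q-quotient  = Q.quotient
    ; p-spf       = p-spf
    ; q-spf       = q-spf
    ; 3≤p         = spf-of-odd p-spf sum₀-odd
    ; 3≤q         = spf-of-odd q-spf sum₁-odd
    ; a-odd       = a-odd
    ; b-odd       = odd-factor Q.quotient sum₁-odd
    }
    where
    module P = Division (division g)
    module Q = Division (division (suc g))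
    divisors≢1 : nodeP t (suc g) ≢ 1 × nodeQ t (suc g) ≢ 1
    divisors≢1 = unexceptional-node g even₁ ¬exceptional
    p-spf : IsSmallestPrimeFactor P.divisor (sum g)
    p-spf = spf-divisor g (proj₁ divisors≢1 ∘ trans (nodeP≡sig (suc g)))
    q-spf : IsSmallestPrimeFactor Q.divisor (sum (suc g))
    q-spf = spf-divisor (suc g) (proj₂ divisors≢1 ∘ trans (nodeQ≡sig (suc g)))
    sum₀-odd : Odd (sum g)
    sum₀-odd = odd+even odd₀ even₁
    a-odd : Odd (t (2 + g))
    a-odd = odd-factor P.quotient sum₀-odd
    sum₁-odd : Odd (sum (suc g))
    sum₁-odd = even+odd even₁ a-odd

  a₀-prime-sum : t (2 + f) ≡ t f + t (suc f) × Prime (t f + t (suc f))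
  a₀-prime-sum = signature-one f (trans (sym (nodeP≡sig (suc f))) p₀≡1)

  b₀-prime-sum : t (3 + f) ≡ t (suc f) + t (2 + f) × Prime (t (suc f) + t (2 + f))
  b₀-prime-sum = signature-one (suc f) (trans (sym (nodeQ≡sig (suc f))) q₀≡1)

  2≤y : 2 ≤ t (suc f)
  2≤y = even⇒≥2 (positive (suc f)) even₀

  a₀-odd : Odd (t (2 + f))
  a₀-odd = subst Odd (sym (proj₁ a₀-prime-sum)) (prime≥3⇒odd (proj₂ a₀-prime-sum) (+-mono-≤ (positive f) 2≤y))

  b₀-odd : Odd (t (3 + f))
  b₀-odd = subst Odd (sym (proj₁ b₀-prime-sum)) (prime≥3⇒odd (proj₂ b₀-prime-sum) (+-mono-≤ 2≤y (positive (2 + f))))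

  u-odd : Odd (t f)
  u-odd even-u = a₀-odd (subst Even (sym (proj₁ a₀-prime-sum)) (∣m∣n⇒∣m+n even-u even₀))

  next-even-position : ∀ e₁ → IsNextEven t (suc f) e₁ → Σ ℕ λ s → e₁ ≡ 3 + f + suc s
  next-even-position e₁ (e₀<e₁ , even₁ , _) = s , trans (sym 4+f+s≡e₁) (sym (+-suc (3 + f) s))
    where
    4+f≤e₁ : 4 + f ≤ e₁
    4+f≤e₁ = ≤∧≢⇒< (≤∧≢⇒< e₀<e₁ λ e → a₀-odd (subst (Even ∘ t) (sym e) even₁))
                   λ e → b₀-odd (subst (Even ∘ t) (sym e) even₁)
    s : ℕ
    s = proj₁ (m≤n⇒∃[o]m+o≡n 4+f≤e₁)
    4+f+s≡e₁ : 4 + f + s ≡ e₁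
    4+f+s≡e₁ = proj₂ (m≤n⇒∃[o]m+o≡n 4+f≤e₁)

  weight-f+m : weight (f + m) ≡ t f + 2 * t (suc f)
  weight-f+m = cong₂ (λ x z → x + 2 * z) (periodic f) (periodic (suc f))

  -- The next even position is e₁ = suc U₁, and its node is (a, b) = (t B, t (suc B)).
  module NextNode (s : ℕ) (next : IsNextEven t (suc f) (3 + f + suc s)) where

    U₁ : ℕ
    U₁ = 2 + f + suc s

    odd-between : ∀ k → suc f < k → k < suc U₁ → Odd (t k)
    odd-between = proj₂ (proj₂ next)

    e₀<U₁ : suc f < U₁
    e₀<U₁ = m≤m+n (2 + f) (suc s)

    first-run : Averaging (suc s) (t f + t (suc f)) (t (suc f) + (t f + t (suc f))) (t U₁) (t (suc U₁))
    first-run = subst₂ (λ a₀ b₀ → Averaging (suc s) a₀ b₀ (t U₁) (t (suc U₁)))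
      (proj₁ a₀-prime-sum) (trans (proj₁ b₀-prime-sum) (cong (t (suc f) +_) (proj₁ a₀-prime-sum)))
      (averaging-on t (2 + f) (suc s) λ j e₀<j j<U₁ →
        averaging-step j (odd-between j e₀<j (m<n⇒m<1+n j<U₁)) (odd-between (suc j) (m<n⇒m<1+n e₀<j) (s≤s j<U₁)))

    e₁<e₀+m : suc U₁ < suc f + m
    e₁<e₀+m = ≤∧≢⇒< e₁≤e₀+m e₁≢e₀+m
      where
      e₁≤e₀+m : suc U₁ ≤ suc f + m
      e₁≤e₀+m = ≮⇒≥ λ e₀+m<e₁ → odd-between (suc f + m) (m<m+n (suc f) (proj₁ minimal)) e₀+m<e₁
                  (subst Even (sym (periodic (suc f))) even₀)
      e₁≢e₀+m : suc U₁ ≢ suc f + m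
      e₁≢e₀+m e₁≡e₀+m = <-irrefl u+2y≡3u+5y (weight-gain (t f) (positive (suc f)))
        where
        u+2y≡3u+5y : t f + 2 * t (suc f) ≡ 3 * t f + 5 * t (suc f)
        u+2y≡3u+5y = begin
          t f + 2 * t (suc f) ≡⟨ weight-f+m ⟨
          weight (f + m)      ≡⟨ cong weight (suc-injective e₁≡e₀+m) ⟨
          weight U₁           ≡⟨ first-run-weight (t f) (t (suc f)) first-run ⟩
          3 * t f + 5 * t (suc f) ∎
          where open ≡-Reasoning

    node₁ : RegularNode U₁
    node₁ = regular-node U₁ (odd-between U₁ e₀<U₁ (n<1+n U₁)) (proj₁ (proj₂ next))
              (inside⇒unexceptional (m<n⇒m<1+n e₀<U₁) e₁<e₀+m)

    open RegularNode node₁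

    B : ℕ
    B = 2 + U₁

    B<f+m : B < f + m
    B<f+m = ≤∧≢⇒< B≤f+m λ B≡f+m →
      b-odd (subst (Even ∘ t ∘ suc) (sym B≡f+m) (subst Even (sym (periodic (suc f))) even₀))
      where
      B≤f+m : B ≤ f + m
      B≤f+m = ≤∧≢⇒< (s≤s⁻¹ e₁<e₀+m) λ e₁≡f+m →
        u-odd (subst Even (trans (cong t e₁≡f+m) (periodic f)) (proj₁ (proj₂ next)))

    s₂ : ℕ
    s₂ = proj₁ (m≤n⇒∃[o]m+o≡n B<f+m)

    B+1+s₂≡f+m : B + suc s₂ ≡ f + m
    B+1+s₂≡f+m = trans (+-suc B s₂) (proj₂ (m≤n⇒∃[o]m+o≡n B<f+m))

    B≤⇒e₀< : ∀ {j} → B ≤ j → suc f < j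
    B≤⇒e₀< B≤j = <-trans e₀<U₁ (<-trans (n<1+n U₁) B≤j)

    two-node-loop : (∀ i → i < suc s₂ → Odd (t (B + i))) → SmallDivisors p q
    two-node-loop odd-after =
      TwoNodeLoop.divisors (positive f) (proj₂ a₀-prime-sum) not-1-2 first-run second-run
        p-spf q-spf p-quotient q-quotient 3≤p 3≤q
      where
      not-1-2 : ¬ (t f ≡ 1 × t (suc f) ≡ 2)
      not-1-2 (u≡1 , y≡2) = no-1-2 f u≡1 y≡2
      odd-until-return : ∀ j → B ≤ j → j ≤ B + suc s₂ → Odd (t j)
      odd-until-return j B≤j j≤end with m≤n⇒m<n∨m≡n j≤end
      ... | inj₁ j<end = subst (Odd ∘ t) (m+[n∸m]≡n B≤j)
        (odd-after (j ∸ B) (+-cancelˡ-< B (j ∸ B) (suc s₂) (subst (_< B + suc s₂) (sym (m+[n∸m]≡n B≤j)) j<end)))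
      ... | inj₂ refl = subst Odd (sym (trans (cong t B+1+s₂≡f+m) (periodic f))) u-odd
      second-run : Averaging (suc s₂) (t B) (t (suc B)) (t f) (t (suc f))
      second-run = subst₂ (Averaging (suc s₂) (t B) (t (suc B)))
        (trans (cong t B+1+s₂≡f+m) (periodic f)) (trans (cong (t ∘ suc) B+1+s₂≡f+m) (periodic (suc f)))
        (averaging-on t B (suc s₂) λ j B≤j j<end →
          averaging-step j (odd-until-return j B≤j (<⇒≤ j<end)) (odd-until-return (suc j) (m≤n⇒m≤1+n B≤j) j<end))

    third-node : ∀ i → suc i < suc s₂ → Even (t (B + suc i)) → (∀ i′ → i′ < suc i → Odd (t (B + i′))) →
                 p ≡ 3 × q ≡ 3
    third-node i 1+i<1+s₂ even odd-before =
      divisors-before-third-node {b = t (suc B)} (positive f) first-run p-quotient q-quotient 3≤p 3≤q weight-drop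
      where
      G : ℕ
      G = B + i
      1+G<f+m : suc G < f + m
      1+G<f+m = subst₂ _<_ (+-suc B i) B+1+s₂≡f+m (+-monoʳ-< B 1+i<1+s₂)
      node₂ : RegularNode G
      node₂ = regular-node G (odd-before i ≤-refl) (subst (Even ∘ t) (+-suc B i) even)
                (inside⇒unexceptional (B≤⇒e₀< (≤-trans (m≤m+n B i) (n≤1+n G))) (<-trans 1+G<f+m (n<1+n (f + m))))
      module N = RegularNode node₂
      up-to-G : weight G ≤ weight B
      up-to-G = antitone-on weight B i λ j B≤j j<G →
        weight-nonincreasing j (B≤⇒e₀< B≤j) (s≤s (<-trans j<G (<-trans (n<1+n G) 1+G<f+m)))
      rest : ℕ
      rest = proj₁ (m≤n⇒∃[o]m+o≡n 1+G<f+m)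
      2+G+rest≡f+m : 2 + G + rest ≡ f + m
      2+G+rest≡f+m = proj₂ (m≤n⇒∃[o]m+o≡n 1+G<f+m)
      from-2+G : weight (f + m) ≤ weight (2 + G)
      from-2+G = subst (λ e → weight e ≤ weight (2 + G)) 2+G+rest≡f+m
        (antitone-on weight (2 + G) rest λ j 2+G≤j j<2+G+rest →
          weight-nonincreasing j (B≤⇒e₀< (≤-trans (m≤m+n B i) (≤-trans (n≤1+n G) (<⇒≤ 2+G≤j))))
            (s≤s (subst (j <_) 2+G+rest≡f+m j<2+G+rest)))
      weight-drop : 18 * (t f + 2 * t (suc f)) ≤ 11 * (t B + 2 * t (suc B))
      weight-drop = begin
        18 * (t f + 2 * t (suc f)) ≡⟨ cong (18 *_) weight-f+m ⟨
        18 * weight (f + m)        ≤⟨ *-monoʳ-≤ 18 from-2+G ⟩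
        18 * weight (2 + G)        ≤⟨ node-weight-drop {t G} {t (suc G)} {t (2 + G)} {t (3 + G)}
                                        (quotient-bound (t (2 + G)) N.3≤p N.p-quotient)
                                        (quotient-bound (t (3 + G)) N.3≤q N.q-quotient) ⟩
        11 * weight G              ≤⟨ *-monoʳ-≤ 11 up-to-G ⟩
        11 * weight B              ∎
        where open ≤-Reasoning

    divisors : SmallDivisors (nodeP t (suc U₁)) (nodeQ t (suc U₁))
    divisors = subst₂ SmallDivisors (sym p-signature) (sym q-signature) small
      where
      small : SmallDivisors p q
      small with first-in-range (λ j → 2 ∣? t j) B (suc s₂)
      ... | inj₁ none = two-node-loop none
      ... | inj₂ (zero , _ , even , _) = ⊥-elim (a-odd (subst (Even ∘ t) (+-identityʳ B) even))
      ... | inj₂ (suc i , 1+i<1+s₂ , even , before) = inj₁ (third-node i 1+i<1+s₂ even before)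

  next-node-divisors : ∀ e₁ → IsNextEven t (suc f) e₁ → SmallDivisors (nodeP t e₁) (nodeQ t e₁)
  next-node-divisors e₁ next with next-even-position e₁ next
  ... | s , refl = NextNode.divisors s next

proposition12 : ∀ (m : ℕ) (t : ℕ → ℕ) → NontrivialCycle m t →
    ∀ (e₀ : ℕ) → 1 ≤ e₀ → e₀ ≤ m → Even (t e₀) →
    nodeP t e₀ ≡ 1 → nodeQ t e₀ ≡ 1 →
    (∀ e → 1 ≤ e → e ≤ m → Even (t e) → e ≢ e₀ →
      nodeP t e ≢ 1 × nodeQ t e ≢ 1) →
    ∀ (e₁ : ℕ) → IsNextEven t e₀ e₁ →
    (nodeP t e₁ ≡ 3 × nodeQ t e₁ ≡ 3)
    ⊎ (nodeP t e₁ ≡ 3 × nodeQ t e₁ ≡ 5)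
    ⊎ (nodeP t e₁ ≡ 5 × nodeQ t e₁ ≡ 3)
proposition12 m t cycle (suc f) _ _ even₀ p₀≡1 q₀≡1 other-nodes =
  AfterExceptionalNode.next-node-divisors cycle f even₀ p₀≡1 q₀≡1 other-nodes
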